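{- There does not exist a total $k$-uniform graph when $k$ is an odd positive integer.
   Context: All graphs are finite and simple. For a vertex $v$ of a graph $G$, $N(v)$ is the set of neighbors of $v$. For a graph $G$ with no isolated vertices, a set $A\subseteq V(G)$ is a total dominating set if every vertex of $G$ has a neighbor in $A$; the total domination number $\gamma_t(G)$ is the minimum size of a total dominating set. A sequence $(v_1,\dots,v_m)$ of distinct vertices is legal if $N(v_i)\setminus\bigcup_{j=1}^{i-1}N(v_j)\neq\emptyset$ for every $i\in\{2,\dots,m\}$; it is a total dominating sequence if moreover $\{v_1,\dots,v_m\}$ is a total dominating set. The Grundy total domination number $\gamma_{gr}^t(G)$ is the maximum length of a total dominating sequence. A graph $G$ (with no isolated vertices) is total $k$-uniform if $\gamma_t(G)=\gamma_{gr}^t(G)=k$, i.e. every total dominating sequence of $G$ has length $k$. -}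

module Defs where

open import Data.Nat using (ℕ; _≤_; _+_; _*_; suc)
open import Data.Fin using (Fin)
open import Data.Bool using (Bool; true; false)
open import Data.List using (List; []; _∷_; length)
open import Data.List.Membership.Propositional using (_∈_)
open import Data.List.Relation.Unary.All using (All)
open import Data.List.Relation.Unary.Unique.Propositional using (Unique)
open import Data.Product using (Σ; ∃; _×_; ∃-syntax)
open import Data.Unit using (⊤)
open import Relation.Binary.PropositionalEquality using (_≡_)

record Graph (n : ℕ) : Set where
  field
    adj    : Fin n → Fin n → Bool
    sym    : ∀ u v → adj u v ≡ adj v u
    irrefl : ∀ v → adj v v ≡ false
open Graph public

module _ {n : ℕ} (G : Graph n) where

  Adj : Fin n → Fin n → Set
  Adj v u = adj G v u ≡ true

  NoIsolated : Set
  NoIsolated = ∀ v → ∃[ u ] Adj v u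

  IsTDS : List (Fin n) → Set
  IsTDS A = Unique A × (∀ v → ∃[ a ] (a ∈ A × Adj a v))

  LegalAfter : List (Fin n) → List (Fin n) → Set
  LegalAfter prev []       = ⊤
  LegalAfter prev (x ∷ xs) =
    (∃[ u ] (Adj x u × All (λ p → adj G p u ≡ false) prev))
    × LegalAfter (x ∷ prev) xs

  Legal : List (Fin n) → Set
  Legal []       = ⊤
  Legal (x ∷ xs) = Unique (x ∷ xs) × LegalAfter (x ∷ []) xs

  IsTDSequence : List (Fin n) → Set
  IsTDSequence s = Legal s × (∀ v → ∃[ a ] (a ∈ s × Adj a v))

  TotalDomNumber : ℕ → Set
  TotalDomNumber k =
    (∃[ A ] (IsTDS A × length A ≡ k)) × (∀ A → IsTDS A → k ≤ length A)

  GrundyTotalDomNumber : ℕ → Set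
  GrundyTotalDomNumber k =
    (∃[ s ] (IsTDSequence s × length s ≡ k))
    × (∀ s → IsTDSequence s → length s ≤ k)

  TotalUniform : ℕ → Set
  TotalUniform k = TotalDomNumber k × GrundyTotalDomNumber k

-- Call a vertex stranded for a legal sequence s if it is not dominated by s
-- while all of its neighbours are.  Build a total dominating sequence two
-- vertices at a time, always appending an undominated vertex v and an
-- undominated neighbour t of v, and keep the invariant that no vertex is
-- stranded.  The invariant survives each step: if u became stranded after
-- appending (w, t), then inserting u just before w gives a longer legal
-- sequence with the same union of neighbourhoods, and any common completion
-- of the two yields total dominating sequences whose lengths differ by one,
-- which uniformity forbids.  Hence the greedy pairing produces a total
-- dominating sequence of even length, so k is even.
module Submission where

open import Defs
open import Data.Nat using (ℕ; suc; _+_; _*_)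
open import Data.Nat.Properties
  using (≤-antisym; +-cancelʳ-≡; +-cancelˡ-≡; +-comm; *-suc; even≢odd)
open import Data.Bool using (true; false; _≟_)
open import Data.Fin using (Fin)
open import Data.Fin.Properties using (any?)
open import Data.List using (List; []; _∷_; _++_; _ʳ++_; length; allFin)
open import Data.List.Properties using (length-++)
open import Data.List.Membership.Propositional using (_∈_; _∉_; find)
open import Data.List.Membership.Propositional.Properties using (∈-allFin)
open import Data.List.Relation.Unary.All as All using (All; []; _∷_; all?)
open import Data.List.Relation.Unary.All.Properties using (++⁺; ++⁻)
open import Data.List.Relation.Unary.Any using (Any; here; there)
open import Data.List.Relation.Unary.Any.Properties using (++⁺ˡ; ++⁺ʳ)
open import Data.List.Relation.Unary.AllPairs using ([]; _∷_)
open import Data.List.Relation.Unary.Unique.Propositional using (Unique)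
open import Data.List.Relation.Binary.Permutation.Propositional using (↭-sym)
open import Data.List.Relation.Binary.Permutation.Propositional.Properties
  using (All-resp-↭; ↭-reverse)
open import Data.Product using (∃-syntax; _×_; _,_; proj₁; proj₂)
open import Data.Sum using (_⊎_; inj₁; inj₂)
open import Data.Unit using (tt)
open import Relation.Binary.PropositionalEquality
  using (_≡_; refl; trans; cong; module ≡-Reasoning)
  renaming (sym to ≡-sym)
open import Relation.Nullary using (¬_; Dec; yes; no; _×-dec_; contradiction)
open import Relation.Unary using (_⊆_; _≐_)

module _ {n : ℕ} (G : Graph n) where

  Undominated : List (Fin n) → Fin n → Set
  Undominated s w = All (λ a → adj G a w ≡ false) s

  Dominated : List (Fin n) → Fin n → Set
  Dominated s w = Any (λ a → Adj G a w) s

  adj-swap : ∀ {u v b} → adj G u v ≡ b → adj G v u ≡ b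
  adj-swap {u} {v} = trans (sym G v u)

  dominated-or-undominated : ∀ s w → Dominated s w ⊎ Undominated s w
  dominated-or-undominated []      w = inj₂ []
  dominated-or-undominated (a ∷ s) w with adj G a w in aw
  ... | true  = inj₁ (here aw)
  ... | false with dominated-or-undominated s w
  ...   | inj₁ d = inj₁ (there d)
  ...   | inj₂ u = inj₂ (aw ∷ u)

  dominated⇒¬undominated : ∀ {s w} → Dominated s w → ¬ Undominated s w
  dominated⇒¬undominated (here aw)  (aw′ ∷ _) with trans (≡-sym aw) aw′
  ... | ()
  dominated⇒¬undominated (there d) (_ ∷ u) = dominated⇒¬undominated d u

  undominated? : ∀ s w → Dec (Undominated s w)
  undominated? s w = all? (λ a → adj G a w ≟ false) s

  neighbour∉ : ∀ {H x u} → Adj G x u → Undominated H u → x ∉ H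
  neighbour∉ xu uH x∈H with trans (≡-sym xu) (All.lookup uH x∈H)
  ... | ()

  legalAfter-fresh : ∀ {H} xs → LegalAfter G H xs → All (_∉ H) xs
  legalAfter-fresh []       _                     = []
  legalAfter-fresh (x ∷ xs) ((_ , xu , uH) , l) =
    neighbour∉ xu uH
    ∷ All.map (λ y∉x∷H y∈H → y∉x∷H (there y∈H)) (legalAfter-fresh xs l)

  legalAfter-unique : ∀ {H} xs → LegalAfter G H xs → Unique xs
  legalAfter-unique []       _       = []
  legalAfter-unique (x ∷ xs) (_ , l) =
    All.map (λ y∉x∷H x≡y → y∉x∷H (here (≡-sym x≡y))) (legalAfter-fresh xs l)
    ∷ legalAfter-unique xs l

  legalAfter⇒legal : ∀ s → LegalAfter G [] s → Legal G s
  legalAfter⇒legal []      _ = tt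
  legalAfter⇒legal (x ∷ s) l = legalAfter-unique (x ∷ s) l , proj₂ l

  legalAfter-mono : ∀ {H H′} r → Undominated H ⊆ Undominated H′ →
                    LegalAfter G H r → LegalAfter G H′ r
  legalAfter-mono []      _    _                    = tt
  legalAfter-mono (x ∷ r) H⊆H′ ((u , xu , uH) , l) =
    (u , xu , H⊆H′ uH) , legalAfter-mono r (λ { (xy ∷ yH) → xy ∷ H⊆H′ yH }) l

  legalAfter-++⁺ : ∀ {H} xs {ys} → LegalAfter G H xs →
                   LegalAfter G (xs ʳ++ H) ys → LegalAfter G H (xs ++ ys)
  legalAfter-++⁺ []       _          l′ = l′
  legalAfter-++⁺ (x ∷ xs) (step , l) l′ = step , legalAfter-++⁺ xs l l′

  -- LegalAfter records its history newest-first, but only the set of vertices matters.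
  legal-++⁺ : ∀ {s r} → LegalAfter G [] s → LegalAfter G s r → LegalAfter G [] (s ++ r)
  legal-++⁺ {s} {r} l l′ =
    legalAfter-++⁺ s l (legalAfter-mono r (All-resp-↭ (↭-sym (↭-reverse s))) l′)

  legal-pair : ∀ {s v t} → LegalAfter G [] s → Adj G v t →
               Undominated s v → Undominated s t → LegalAfter G [] (s ++ v ∷ t ∷ [])
  legal-pair {v = v} {t} l vt vS tS =
    legal-++⁺ l ((t , vt , tS) , (v , adj-swap vt , irrefl G v ∷ vS) , tt)

  tdSequence-length : ∀ {k} → TotalUniform G k → ∀ {s} → LegalAfter G [] s →
                      (∀ v → Dominated s v) → length s ≡ k
  tdSequence-length ((_ , γt≤) , (_ , ≤γgr)) {s} l dom =
    ≤-antisym (≤γgr s (legalAfter⇒legal s l , dominating))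
              (γt≤ s (legalAfter-unique s l , dominating))
    where
    dominating : ∀ v → ∃[ a ] (a ∈ s × Adj G a v)
    dominating v = find (dom v)

  Stranded : List (Fin n) → Fin n → Set
  Stranded s u = Undominated s u × (∀ y → Adj G u y → Dominated s y)

  undominated-neighbour : ∀ {s u} → ¬ Stranded s u → Undominated s u →
                          ∃[ t ] (Adj G u t × Undominated s t)
  undominated-neighbour {s} {u} ¬stranded uS
    with any? (λ t → (adj G u t ≟ true) ×-dec undominated? s t)
  ... | yes found = found
  ... | no none   = contradiction (uS , dominated) ¬stranded
    where
    dominated : ∀ y → Adj G u y → Dominated s y
    dominated y uy with dominated-or-undominated s y
    ... | inj₁ yD = yD
    ... | inj₂ yS = contradiction (y , uy , yS) none

  stranded⇒nonadjacent : ∀ {s u y} → Stranded s u → Undominated s y → adj G u y ≡ false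
  stranded⇒nonadjacent {u = u} {y} (_ , dominated) yS with adj G u y in uy
  ... | false = refl
  ... | true  = contradiction yS (dominated⇒¬undominated (dominated y uy))

  record PairBuilt (s : List (Fin n)) : Set where
    field
      legal         : LegalAfter G [] s
      half          : ℕ
      length≡2*half : length s ≡ 2 * half
      unstranded    : ∀ u → ¬ Stranded s u

  module _ (noIsolated : NoIsolated G) where

    completion : ∀ H vs → ∃[ r ] (LegalAfter G H r ×
                   All (λ v → Undominated H v → Dominated r v) vs)
    completion H []       = [] , tt , []
    completion H (v ∷ vs) with undominated? H v
    ... | no ¬vH with completion H vs
    ...   | r , l , dom = r , l , (λ vH → contradiction vH ¬vH) ∷ dom
    completion H (v ∷ vs) | yes vH with noIsolated v
    ...   | x , vx with completion (x ∷ H) vs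
    ...     | r , l , dom =
      x ∷ r , ((v , adj-swap vx , vH) , l) , (λ _ → here (adj-swap vx)) ∷ All.map extend dom
      where
      extend : ∀ {w} → (Undominated (x ∷ H) w → Dominated r w) →
               Undominated H w → Dominated (x ∷ r) w
      extend {w} k wH with adj G x w in xw
      ... | true  = here xw
      ... | false = there (k (xw ∷ wH))

    module _ {k : ℕ} (uniform : TotalUniform G k) where

      equal-neighbourhoods⇒equal-length :
        ∀ {s₁ s₂} → LegalAfter G [] s₁ → LegalAfter G [] s₂ →
        Undominated s₁ ≐ Undominated s₂ → length s₁ ≡ length s₂
      equal-neighbourhoods⇒equal-length {s₁} {s₂} l₁ l₂ (1⊆2 , 2⊆1)
        with completion s₁ (allFin n)
      ... | r , lr , dom =
        +-cancelʳ-≡ (length r) (length s₁) (length s₂)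
          (trans (completed-length l₁ (λ x → x) (λ x → x))
                 (≡-sym (completed-length l₂ 1⊆2 2⊆1)))
        where
        completed-length : ∀ {s} → LegalAfter G [] s → Undominated s₁ ⊆ Undominated s →
                           Undominated s ⊆ Undominated s₁ → length s + length r ≡ k
        completed-length {s} l 1⊆ ⊆1 =
          trans (≡-sym (length-++ s))
                (tdSequence-length uniform (legal-++⁺ l (legalAfter-mono r 1⊆ lr)) dominated)
          where
          dominated : ∀ v → Dominated (s ++ r) v
          dominated v with dominated-or-undominated s v
          ... | inj₁ vD = ++⁺ˡ vD
          ... | inj₂ vS = ++⁺ʳ s (All.lookup dom (∈-allFin v) (⊆1 vS))

      pair-unstrands : ∀ {s w t} → LegalAfter G [] s → (∀ u → ¬ Stranded s u) →
                       Adj G w t → Undominated s w → Undominated s t →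
                       ∀ u → ¬ Stranded (s ++ w ∷ t ∷ []) u
      pair-unstrands {s} {w} {t} l unstranded wt wS tS u stranded
        with ++⁻ s (proj₁ stranded)
      ... | uS , wu ∷ tu ∷ [] with undominated-neighbour (unstranded u) uS
      ...   | t₀ , ut₀ , t₀S = contradiction (+-cancelˡ-≡ (length s) 3 2 lengths) λ ()
        where
        open ≡-Reasoning
        longer : LegalAfter G [] (s ++ u ∷ w ∷ t ∷ [])
        longer = legal-++⁺ l ((t₀ , ut₀ , t₀S) , (t , wt , adj-swap tu ∷ tS) ,
                              (w , adj-swap wt , irrefl G w ∷ adj-swap wu ∷ wS) , tt)
        same-neighbourhoods :
          Undominated (s ++ w ∷ t ∷ []) ≐ Undominated (s ++ u ∷ w ∷ t ∷ [])
        same-neighbourhoods = insert , delete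
          where
          insert : Undominated (s ++ w ∷ t ∷ []) ⊆ Undominated (s ++ u ∷ w ∷ t ∷ [])
          insert yS′ with ++⁻ s yS′
          ... | yS , yWT = ++⁺ yS (stranded⇒nonadjacent stranded yS′ ∷ yWT)
          delete : Undominated (s ++ u ∷ w ∷ t ∷ []) ⊆ Undominated (s ++ w ∷ t ∷ [])
          delete yS″ with ++⁻ s yS″
          ... | yS , _ ∷ yWT = ++⁺ yS yWT
        lengths : length s + 3 ≡ length s + 2
        lengths = begin
          length s + 3                  ≡⟨ length-++ s ⟨
          length (s ++ u ∷ w ∷ t ∷ [])  ≡⟨ equal-neighbourhoods⇒equal-length
                                               (legal-pair l wt wS tS) longer same-neighbourhoods ⟨
          length (s ++ w ∷ t ∷ [])      ≡⟨ length-++ s ⟩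
          length s + 2                  ∎

      pairBuilt-[] : PairBuilt []
      pairBuilt-[] = record
        { legal         = tt
        ; half          = 0
        ; length≡2*half = refl
        ; unstranded    = λ u (_ , dominated) →
                            contradiction (dominated _ (proj₂ (noIsolated u))) λ ()
        }

      pairBuilt-extend : ∀ {s v t} → PairBuilt s → Adj G v t →
                         Undominated s v → Undominated s t → PairBuilt (s ++ v ∷ t ∷ [])
      pairBuilt-extend {s} {v} {t} built vt vS tS = record
        { legal         = legal-pair legal vt vS tS
        ; half          = suc half
        ; length≡2*half = length-step
        ; unstranded    = pair-unstrands legal unstranded vt vS tS
        }
        where
        open PairBuilt built
        open ≡-Reasoning
        length-step : length (s ++ v ∷ t ∷ []) ≡ 2 * suc half
        length-step = begin
          length (s ++ v ∷ t ∷ [])  ≡⟨ length-++ s ⟩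
          length s + 2              ≡⟨ cong (_+ 2) length≡2*half ⟩
          2 * half + 2              ≡⟨ +-comm (2 * half) 2 ⟩
          2 + 2 * half              ≡⟨ *-suc 2 half ⟨
          2 * suc half              ∎

      pair-sequence : ∀ vs → ∃[ s ] (PairBuilt s × All (Dominated s) vs)
      pair-sequence []       = [] , pairBuilt-[] , []
      pair-sequence (v ∷ vs) with pair-sequence vs
      ... | s , built , dom with dominated-or-undominated s v
      ...   | inj₁ vD = s , built , vD ∷ dom
      ...   | inj₂ vS with undominated-neighbour (PairBuilt.unstranded built v) vS
      ...     | t , vt , tS = s ++ v ∷ t ∷ [] , pairBuilt-extend built vt vS tS ,
                              ++⁺ʳ s (there (here (adj-swap vt))) ∷ All.map ++⁺ˡ dom

theorem2p3 : (k : ℕ) → ∃[ m ] (k ≡ suc (2 * m)) →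
    (n : ℕ) (G : Graph n) → NoIsolated G → ¬ TotalUniform G k
theorem2p3 k (m , k≡2m+1) n G noIsolated uniform
  with pair-sequence G noIsolated uniform (allFin n)
... | s , built , dom = even≢odd half m (begin
  2 * half    ≡⟨ length≡2*half ⟨
  length s    ≡⟨ tdSequence-length G uniform legal (λ v → All.lookup dom (∈-allFin v)) ⟩
  k           ≡⟨ k≡2m+1 ⟩
  suc (2 * m) ∎)
  where
  open PairBuilt built
  open ≡-Reasoning
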